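{- If $\pi$ is a Fishburn permutation, then $\upsilon(\pi)=\tilde\upsilon(\pi)$.
   Context: A permutation $\pi\in S_n$ (one-line notation) is a Fishburn permutation if there are no indices $i$ and $k>i+1$ with $\pi(k)<\pi(i)<\pi(i+1)$ and $\pi(i)=\pi(k)+1$. For $\pi\in S_n$ and $i\in[n]$ let $J(i)=0$ if $\pi(i)=1$ and otherwise let $J(i)$ be the index with $\pi(J(i))=\pi(i)-1$. The sites of $\pi$ are $0,1,\dots,n$ (site $0$ is before $\pi(1)$, site $i\ge1$ immediately after $\pi(i)$). Site $0$ is both Fishburn-active and $\eta$-active. For $i\ge1$, site $i$ is Fishburn-active iff $J(i)<i$, and $\eta$-active iff $J(i)<i$ or ($i<n$ and $\pi(i)<\pi(i+1)$). Define $\upsilon(\pi)$ (resp. $\tilde\upsilon(\pi)$) as the word of length $n$ whose $j$-th entry is the number of Fishburn-active (resp. $\eta$-active) sites among $0,1,\dots,j-1$; i.e., every entry lying between the $k$-th and $(k+1)$-st active site receives label $k$. -}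

module Defs where

open import Data.Nat using (ℕ; zero; suc; _<_; _<?_)
open import Data.Fin using (Fin; zero; suc; toℕ; inject₁)
import Data.Fin as F
open import Data.Fin.Properties using (any?)
open import Data.Fin.Permutation using (Permutation′; _⟨$⟩ʳ_; _⟨$⟩ˡ_)
open import Data.List using (List; length; filter)
open import Data.List using () renaming (length to len)
open import Data.Fin.Base using () 
open import Data.List.Base using ()
import Data.List as L
open import Data.Product using (Σ; ∃; _×_; _,_)
open import Data.Sum using (_⊎_)
open import Data.Bool using (Bool; true; false)
open import Relation.Binary.PropositionalEquality using (_≡_)
open import Relation.Nullary using (¬_; Dec)
open import Relation.Nullary.Decidable using (_⊎-dec_; _×-dec_)
import Data.Nat.Properties as ℕP

-- Positions and values are 0-based: the paper's
-- position p ∈ {1..n} is the Fin n element i with toℕ i = p - 1, and the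
-- paper's value π(p) is toℕ (π ⟨$⟩ʳ i) + 1.  The order on values is the
-- order on Fin n (toℕ), which is preserved by this shift.

IsFishburn : ∀ {n} → Permutation′ n → Set
IsFishburn {n} π =
  ¬ (Σ (Fin n) λ i → Σ (Fin n) λ i' → Σ (Fin n) λ k →
       (toℕ i' ≡ suc (toℕ i)) × (suc (toℕ i) < toℕ k) ×
       (toℕ (π ⟨$⟩ʳ k) < toℕ (π ⟨$⟩ʳ i)) ×
       (toℕ (π ⟨$⟩ʳ i) < toℕ (π ⟨$⟩ʳ i')) ×
       (toℕ (π ⟨$⟩ʳ i) ≡ suc (toℕ (π ⟨$⟩ʳ k))))

-- J for a value: if the value is 1 (0-based: zero), J = 0; otherwise J is the
-- (1-based) position of the value one smaller.
Jval : ∀ {n} → Permutation′ n → Fin n → ℕ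
Jval π zero    = 0
Jval π (suc x) = suc (toℕ (π ⟨$⟩ˡ inject₁ x))

J : ∀ {n} → Permutation′ n → Fin n → ℕ
J π i = Jval π (π ⟨$⟩ʳ i)

FishActive : ∀ {n} → Permutation′ n → Fin n → Set
FishActive π i = J π i < suc (toℕ i)

fishActive? : ∀ {n} (π : Permutation′ n) (i : Fin n) → Dec (FishActive π i)
fishActive? π i = J π i <? suc (toℕ i)

AscentAt : ∀ {n} → Permutation′ n → Fin n → Set
AscentAt {n} π i = ∃ λ (j : Fin n) → (toℕ j ≡ suc (toℕ i)) × (toℕ (π ⟨$⟩ʳ i) < toℕ (π ⟨$⟩ʳ j))

ascentAt? : ∀ {n} (π : Permutation′ n) (i : Fin n) → Dec (AscentAt π i)
ascentAt? π i = any? (λ j → (toℕ j Data.Nat.≟ suc (toℕ i)) ×-dec (toℕ (π ⟨$⟩ʳ i) <? toℕ (π ⟨$⟩ʳ j)))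

EtaActive : ∀ {n} → Permutation′ n → Fin n → Set
EtaActive π i = FishActive π i ⊎ AscentAt π i

etaActive? : ∀ {n} (π : Permutation′ n) (i : Fin n) → Dec (EtaActive π i)
etaActive? π i = fishActive? π i ⊎-dec ascentAt? π i

-- Number of active sites among 0, 1, ..., j-1 for the entry at 1-based
-- position j = toℕ e + 1: site 0 (always active) plus the sites
-- p = toℕ i + 1 with 1 ≤ p ≤ j - 1, i.e. toℕ i < toℕ e.
countActive : ∀ {n} {P : Fin n → Set} → ((i : Fin n) → Dec (P i)) → Fin n → ℕ
countActive {n} P? e =
  suc (L.length (L.filter (λ i → (toℕ i <? toℕ e) ×-dec P? i) (L.allFin n)))

-- υ(π) and υ̃(π) as words of length n (functions on Fin n).
υ : ∀ {n} → Permutation′ n → Fin n → ℕ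
υ π = countActive (fishActive? π)

υ̃ : ∀ {n} → Permutation′ n → Fin n → ℕ
υ̃ π = countActive (etaActive? π)

-- An η-active site differs from a Fishburn-active one only through an ascent π(i) < π(i+1).
-- At such an ascent with π(i) = m + 1 > 1, let k be the position of m. Then k ≠ i, i+1 since
-- π(k) < π(i) < π(i+1), and k > i+1 would be exactly the forbidden Fishburn pattern;
-- hence k < i, i.e. J(i) < i, and the site is Fishburn-active anyway. So both kinds of
-- active sites coincide, and so do the words counting them.
module Submission where

open import Defs
open import Data.Nat using (ℕ; suc; _<_; z≤n; s≤s; _<?_)
open import Data.Nat.Properties using (≤∧≢⇒<; ≮⇒≥; <-irrefl; n<1+n; <-trans)
open import Data.Fin using (Fin; zero; suc; toℕ; inject₁)
open import Data.Fin.Properties using (toℕ-inject₁; toℕ-injective)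
open import Data.Fin.Permutation using (Permutation′; _⟨$⟩ʳ_; _⟨$⟩ˡ_; inverseʳ)
open import Data.List using (allFin; length)
open import Data.List.Properties using (filter-≐)
open import Data.Product using (_,_)
open import Data.Sum using (inj₁; inj₂)
open import Relation.Nullary using (¬_; yes; no; contradiction)
open import Relation.Binary.PropositionalEquality using (_≡_; refl; sym; trans; cong; subst)

toℕ-⟨$⟩ʳ-⟨$⟩ˡ-inject₁ : ∀ {n} (π : Permutation′ (suc n)) x → toℕ (π ⟨$⟩ʳ (π ⟨$⟩ˡ inject₁ x)) ≡ toℕ x
toℕ-⟨$⟩ʳ-⟨$⟩ˡ-inject₁ π x = trans (cong toℕ (inverseʳ π)) (toℕ-inject₁ x)

ascent⇒predecessor-before : ∀ {n} (π : Permutation′ (suc n)) → IsFishburn π →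
                            ∀ {i x} → AscentAt π i → π ⟨$⟩ʳ i ≡ suc x →
                            toℕ (π ⟨$⟩ˡ inject₁ x) < toℕ i
ascent⇒predecessor-before π fishburn {i} {x} (j , j≡1+i , πi<πj) πi≡1+x
  with toℕ (π ⟨$⟩ˡ inject₁ x) <? toℕ i
... | yes k<i = k<i
... | no  k≮i = contradiction (i , j , k , j≡1+i , 1+i<k , πk<πi , πi<πj , πi≡1+πk) fishburn
  where
  k = π ⟨$⟩ˡ inject₁ x
  πi≡1+πk : toℕ (π ⟨$⟩ʳ i) ≡ suc (toℕ (π ⟨$⟩ʳ k))
  πi≡1+πk = trans (cong toℕ πi≡1+x) (cong suc (sym (toℕ-⟨$⟩ʳ-⟨$⟩ˡ-inject₁ π x)))
  πk<πi : toℕ (π ⟨$⟩ʳ k) < toℕ (π ⟨$⟩ʳ i)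
  πk<πi = subst (toℕ (π ⟨$⟩ʳ k) <_) (sym πi≡1+πk) (n<1+n _)
  same-position⇒¬< : ∀ {a b} → toℕ a ≡ toℕ b → ¬ toℕ (π ⟨$⟩ʳ b) < toℕ (π ⟨$⟩ʳ a)
  same-position⇒¬< a≡b = <-irrefl (cong (λ z → toℕ (π ⟨$⟩ʳ z)) (toℕ-injective (sym a≡b)))
  i<k : toℕ i < toℕ k
  i<k = ≤∧≢⇒< (≮⇒≥ k≮i) (λ i≡k → same-position⇒¬< i≡k πk<πi)
  1+i<k : suc (toℕ i) < toℕ k
  1+i<k = ≤∧≢⇒< i<k (λ 1+i≡k → same-position⇒¬< (trans j≡1+i 1+i≡k) (<-trans πk<πi πi<πj))

ascent⇒fishActive : ∀ {n} (π : Permutation′ n) → IsFishburn π → ∀ {i} → AscentAt π i → FishActive π i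
ascent⇒fishActive {0}     _ _        {()} _
ascent⇒fishActive {suc n} π fishburn {i}  ascent = J<1+i (π ⟨$⟩ʳ i) refl
  where
  J<1+i : ∀ v → π ⟨$⟩ʳ i ≡ v → Jval π v < suc (toℕ i)
  J<1+i zero    _      = s≤s z≤n
  J<1+i (suc x) πi≡1+x = s≤s (ascent⇒predecessor-before π fishburn ascent πi≡1+x)

etaActive⇒fishActive : ∀ {n} (π : Permutation′ n) → IsFishburn π → ∀ {i} → EtaActive π i → FishActive π i
etaActive⇒fishActive π fishburn (inj₁ active) = active
etaActive⇒fishActive π fishburn (inj₂ ascent) = ascent⇒fishActive π fishburn ascent

mainTheorem18 : (n : ℕ) (π : Permutation′ n) → IsFishburn π → ∀ j → υ π j ≡ υ̃ π j
mainTheorem18 n π fishburn j = cong (λ sites → suc (length sites))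
  (filter-≐ _ _ ((λ (i<j , active) → i<j , inj₁ active) ,
                 (λ (i<j , active) → i<j , etaActive⇒fishActive π fishburn active))
            (allFin n))
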